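{- Let $s\ge2$ and $(m_1,\dots,m_s)\in\mathbb Z_{>0}^s$. Then $(m_1,\dots,m_s)$ lies in the image of $\lambda$ if and only if $(m_1,\dots,m_s)$ is realizable.
   Context: For $s\ge2$ define $\lambda:\mathbb Z_{>0}^s\to\mathbb Z_{>0}^s$ by $\lambda(a_1,\dots,a_s)=(l_1,\dots,l_s)$ with $l_i=\mathrm{lcm}\{\gcd(a_j,a_i): 1\le j\le s,\ j\ne i\}$. A tuple $(a_1,\dots,a_s)\in\mathbb Z_{>0}^s$ is called realizable if for every prime $p$ there exist indices $i\ne j$ with $\nu_p(a_i)=\nu_p(a_j)=\max\{\nu_p(a_1),\dots,\nu_p(a_s)\}$, where $\nu_p$ denotes the exponent of $p$. -}

module Defs where

open import Data.Nat using (ℕ; zero; suc; _+_; _^_; _≥_)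
open import Data.Nat.GCD using (gcd)
open import Data.Nat.LCM using (lcm)
open import Data.Nat.Divisibility using (_∣_)
open import Data.Nat.Primality using (Prime)
open import Data.Fin using (Fin; _≟_)
open import Data.List using (List; foldr; filter)
open import Data.List.Base using (allFin)
open import Data.Product using (_×_; ∃; ∃-syntax; Σ-syntax)
open import Relation.Nullary using (¬_)
open import Relation.Nullary.Decidable using (¬?)
open import Relation.Binary.PropositionalEquality using (_≡_; _≢_)

Tuple : ℕ → Set
Tuple s = Fin s → ℕ

Positive : ∀ {s} → Tuple s → Set
Positive {s} a = (i : Fin s) → a i ≢ 0

lcmList : List ℕ → ℕ
lcmList = foldr lcm 1

lam : ∀ {s} → Tuple s → Tuple s
lam {s} a i = lcmList (Data.List.map (λ j → gcd (a j) (a i)) (filter (λ j → ¬? (j ≟ i)) (allFin s)))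

IsVal : ℕ → ℕ → ℕ → Set
IsVal p n k = (p ^ k ∣ n) × ¬ (p ^ (suc k) ∣ n)

Realizable : ∀ {s} → Tuple s → Set
Realizable {s} a = ∀ p → Prime p →
  ∃[ i ] ∃[ j ] (i ≢ j × ∃[ k ] (IsVal p (a i) k × IsVal p (a j) k × ((l : Fin s) → ¬ (p ^ (suc k) ∣ a l))))

InImage : ∀ {s} → Tuple s → Set
InImage {s} m = ∃[ a ] (Positive a × ((i : Fin s) → lam a i ≡ m i))

{-# OPTIONS --safe #-}
module Submission where

-- Fix a prime p and write e_l for the p-adic valuation of a_l. The exponent of p in λ(a)_l is
-- max_{j ≠ l} min(e_j, e_l). If e is largest at i and K is the largest value of e off i (attained
-- at j), then p^(K+1) divides a_l only for l = i, so it divides no λ(a)_l (that would need two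
-- distinct indices), while p^K divides λ(a)_i and λ(a)_j: λ(a) is realizable. Conversely λ(m)_i
-- always divides m_i, and when m is realizable every prime power dividing m_i also divides some
-- m_j with j ≠ i (one of the two indices of maximal exponent), hence divides gcd(m_j, m_i) ∣
-- λ(m)_i; so λ(m) = m.

open import Defs
open import Algebra.Properties.CommutativeSemigroup using (xy∙z≈xz∙y)
open import Data.Fin using (Fin; zero; _≟_; punchIn; punchOut)
open import Data.Fin.Properties using (punchInᵢ≢i; punchIn-punchOut)
open import Data.List using (List; []; _∷_; map; filter; allFin)
open import Data.List.Extrema.Nat using (argmax; f[xs]≤f[argmax])
open import Data.List.Membership.Propositional using (_∈_)
open import Data.List.Membership.Propositional.Properties using (∈-allFin; ∈-map∘filter⁺; ∈-map∘filter⁻)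
open import Data.List.Relation.Unary.All as All using (_∷_)
open import Data.List.Relation.Unary.Any using (here; there)
open import Data.Nat
  using (ℕ; zero; suc; _*_; _^_; _≤_; _<_; _≥_; z≤n; s≤s; z<s; NonZero; ≢-nonZero; nonTrivial⇒n>1)
open import Data.Nat.Divisibility
  using (_∣_; divides; _∣?_; 1∣_; _∣0; ∣-trans; ∣1⇒≡1; ∣⇒≤; m∣m*n; *-pres-∣; *-monoʳ-∣; *-monoˡ-∣; *-cancelˡ-∣; *-cancelʳ-∣)
open import Data.Nat.GCD using (gcd; gcd[m,n]∣m; gcd[m,n]∣n; gcd-greatest)
open import Data.Nat.Induction using (<-wellFounded)
open import Data.Nat.LCM using (lcm; m∣lcm[m,n]; n∣lcm[m,n]; lcm-least; lcm-comm)
open import Data.Nat.Primality using (Prime; euclidsLemma; prime⇒nonTrivial; prime⇒nonZero)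
open import Data.Nat.Primality.Factorisation using (factorise)
open import Data.Nat.Properties
  using ( ≤-refl; ≤-total; ≤-<-trans; ≮⇒≥; <⇒≱; <-irrefl; >⇒≢; n<1+n; m<m*n; ^-monoʳ-<; m^n≢0
        ; *-comm; *-identityˡ; *-identityʳ; *-commutativeSemigroup)
open import Data.Product using (_×_; _,_; proj₁; proj₂; ∃; ∃-syntax)
open import Data.Sum using (_⊎_; inj₁; inj₂)
open import Function using (_∘_; case_of_)
open import Function.Bundles using (_⇔_; mk⇔)
open import Induction.WellFounded using (Acc; acc)
open import Relation.Binary.PropositionalEquality using (_≡_; _≢_; _≗_; refl; sym; trans; subst)
open import Relation.Nullary using (¬_; yes; no; contradiction)
open import Relation.Nullary.Decidable using (¬?)

^-monoʳ-∣ : ∀ p {m n} → m ≤ n → p ^ m ∣ p ^ n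
^-monoʳ-∣ p z≤n       = 1∣ _
^-monoʳ-∣ p (s≤s m≤n) = *-monoʳ-∣ p (^-monoʳ-∣ p m≤n)

n<m^n : ∀ {m} → 1 < m → ∀ n → n < m ^ n
n<m^n 1<m zero    = s≤s z≤n
n<m^n 1<m (suc n) = ≤-<-trans (n<m^n 1<m n) (^-monoʳ-< _ 1<m (n<1+n n))

prime⇒1<p : ∀ {p} → Prime p → 1 < p
prime⇒1<p {p} p-prime = nonTrivial⇒n>1 p {{prime⇒nonTrivial p-prime}}

∃-prime-divisor : ∀ {n} → 1 < n → ∃[ p ] (Prime p × p ∣ n)
∃-prime-divisor {n} 1<n with factorise n {{≢-nonZero λ { refl → contradiction 1<n λ () }}}
... | record { factors = [] ; isFactorisation = n≡1 } = contradiction 1<n (<-irrefl (sym n≡1))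
... | record { factors = p ∷ _ ; isFactorisation = eq ; factorsPrime = p-prime ∷ _ } =
  p , p-prime , subst (p ∣_) (sym eq) (m∣m*n _)

prime-powers-∣⇒≡ : ∀ {d n} → n ≢ 0 → d ∣ n → (∀ p k → Prime p → p ^ k ∣ n → p ^ k ∣ d) → d ≡ n
prime-powers-∣⇒≡ n≢0 (divides zero n≡0) _ = contradiction n≡0 n≢0
prime-powers-∣⇒≡ _ (divides 1 n≡1*d) _ = sym (trans n≡1*d (*-identityˡ _))
-- A prime factor p of a cofactor q > 1 would make every power of p divide n.
prime-powers-∣⇒≡ {d} {n} n≢0 (divides q@(suc (suc _)) n≡q*d) pᵏ∣n⇒pᵏ∣d
  with p , p-prime , p∣q ← ∃-prime-divisor {q} (s≤s (s≤s z≤n)) =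
  contradiction (∣⇒≤ {{≢-nonZero n≢0}} (pᵏ∣n n)) (<⇒≱ (n<m^n (prime⇒1<p p-prime) n))
  where
  pᵏ∣n : ∀ k → p ^ k ∣ n
  pᵏ∣n zero    = 1∣ n
  pᵏ∣n (suc k) = subst (p ^ suc k ∣_) (sym n≡q*d) (*-pres-∣ p∣q (pᵏ∣n⇒pᵏ∣d p k p-prime (pᵏ∣n k)))

lcmList-least : ∀ {n} xs → (∀ {x} → x ∈ xs → x ∣ n) → lcmList xs ∣ n
lcmList-least []       _     = 1∣ _
lcmList-least (x ∷ xs) xs∣n = lcm-least (xs∣n (here refl)) (lcmList-least xs (xs∣n ∘ there))

∈⇒∣lcmList : ∀ {x xs} → x ∈ xs → x ∣ lcmList xs
∈⇒∣lcmList {xs = x ∷ xs} (here refl) = m∣lcm[m,n] x (lcmList xs)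
∈⇒∣lcmList {xs = x ∷ xs} (there x∈xs) = ∣-trans (∈⇒∣lcmList x∈xs) (n∣lcm[m,n] x (lcmList xs))

^∤⇒≤ : ∀ p {k c n} → ¬ (p ^ suc k ∣ n) → p ^ c ∣ n → c ≤ k
^∤⇒≤ p pᵏ⁺¹∤n pᶜ∣n = ≮⇒≥ (λ k<c → pᵏ⁺¹∤n (∣-trans (^-monoʳ-∣ p k<c) pᶜ∣n))

IsVal⇒^∣ : ∀ p {n k c} → IsVal p n k → c ≤ k → p ^ c ∣ n
IsVal⇒^∣ p (pᵏ∣n , _) c≤k = ∣-trans (^-monoʳ-∣ p c≤k) pᵏ∣n

module _ {p : ℕ} where

  IsVal-*p : ∀ {q k} .{{_ : NonZero p}} → IsVal p q k → IsVal p (q * p) (suc k)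
  IsVal-*p {q} {k} (pᵏ∣q , pᵏ⁺¹∤q) =
    subst (p ^ suc k ∣_) (*-comm p q) (*-monoʳ-∣ p pᵏ∣q) ,
    λ pᵏ⁺²∣qp → pᵏ⁺¹∤q (*-cancelˡ-∣ p (subst (p ^ suc (suc k) ∣_) (*-comm q p) pᵏ⁺²∣qp))

  valuation : 1 < p → ∀ n → n ≢ 0 → ∃ (IsVal p n)
  -- matching 1<p exposes p = suc _, which provides the NonZero p instance
  valuation 1<p@(s≤s _) n = go n (<-wellFounded n)
    where
    go : ∀ n → Acc _<_ n → n ≢ 0 → ∃ (IsVal p n)
    go n (acc smaller) n≢0 with p ∣? n
    ... | no p∤n = 0 , 1∣ n , p∤n ∘ subst (_∣ n) (*-identityʳ p)
    ... | yes (divides q refl) =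
      let k , val = go q (smaller (m<m*n q p {{≢-nonZero q≢0}} 1<p)) q≢0
      in  suc k , IsVal-*p {k = k} val
      where
      q≢0 : q ≢ 0
      q≢0 refl = n≢0 refl

  valuations : ∀ {s} → 1 < p → (a : Tuple s) → Positive a → ∃[ e ] (∀ l → IsVal p (a l) (e l))
  valuations 1<p a a⁺ =
    (λ l → proj₁ (valuation 1<p (a l) (a⁺ l))) , (λ l → proj₂ (valuation 1<p (a l) (a⁺ l)))

  module _ (p-prime : Prime p) where
    private instance
      p≢0 : NonZero p
      p≢0 = prime⇒nonZero p-prime

    IsVal⇒cofactor : ∀ {x a} → IsVal p x a → ∃[ x' ] (x ≡ x' * p ^ a × ¬ p ∣ x')
    IsVal⇒cofactor {a = a} (divides x' x≡x'pᵃ , pᵃ⁺¹∤x) =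
      x' , x≡x'pᵃ , λ p∣x' → pᵃ⁺¹∤x (subst (p ^ suc a ∣_) (sym x≡x'pᵃ) (*-monoˡ-∣ (p ^ a) p∣x'))

    IsVal⇒^∤* : ∀ {x a u} → IsVal p x a → ¬ p ∣ u → ¬ p ^ suc a ∣ x * u
    IsVal⇒^∤* {a = a} {u} val p∤u pᵃ⁺¹∣xu with x' , refl , p∤x' ← IsVal⇒cofactor {a = a} val
      with euclidsLemma x' u p-prime
             (*-cancelʳ-∣ (p ^ a) {{m^n≢0 p a}}
               (subst (p ^ suc a ∣_) (xy∙z≈xz∙y *-commutativeSemigroup x' (p ^ a) u) pᵃ⁺¹∣xu))
    ... | inj₁ p∣x' = p∤x' p∣x'
    ... | inj₂ p∣u  = p∤u p∣u

    IsVal⇒^∤lcm : ∀ {x y a b} → IsVal p x a → IsVal p y b → b ≤ a → ¬ p ^ suc a ∣ lcm x y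
    IsVal⇒^∤lcm {x} {a = a} {b} valx valy b≤a pᵃ⁺¹∣lcm
      with y' , refl , p∤y' ← IsVal⇒cofactor {a = b} valy =
      IsVal⇒^∤* {x} {a} valx p∤y' (∣-trans pᵃ⁺¹∣lcm (lcm-least (m∣m*n {x} y') y∣xy'))
      where
      y∣xy' : y' * p ^ b ∣ x * y'
      y∣xy' = subst (y' * p ^ b ∣_) (*-comm y' x) (*-monoʳ-∣ y' (IsVal⇒^∣ p valx b≤a))

    ^∣lcm⇒⊎ : ∀ {c} x y → p ^ c ∣ lcm x y → p ^ c ∣ x ⊎ p ^ c ∣ y
    ^∣lcm⇒⊎ zero    _ _ = inj₁ (_ ∣0)
    ^∣lcm⇒⊎ (suc _) zero _ = inj₂ (_ ∣0)
    ^∣lcm⇒⊎ {c} x@(suc _) y@(suc _) pᶜ∣lcm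
      with a , valx ← valuation (prime⇒1<p p-prime) x (λ ())
         | b , valy ← valuation (prime⇒1<p p-prime) y (λ ())
         | ≤-total b a
    ... | inj₁ b≤a = inj₁ (IsVal⇒^∣ p {k = a} {c} valx (^∤⇒≤ p (IsVal⇒^∤lcm {a = a} valx valy b≤a) pᶜ∣lcm))
    ... | inj₂ a≤b = inj₂ (IsVal⇒^∣ p {k = b} {c} valy (^∤⇒≤ p (IsVal⇒^∤lcm {a = b} valy valx a≤b) pᶜ∣lcm′))
      where
      pᶜ∣lcm′ : p ^ c ∣ lcm y x
      pᶜ∣lcm′ = subst (p ^ c ∣_) (lcm-comm x y) pᶜ∣lcm

    ^∣lcmList⇒∈ : ∀ {c} xs → p ^ suc c ∣ lcmList xs → ∃[ x ] (x ∈ xs × p ^ suc c ∣ x)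
    ^∣lcmList⇒∈ {c} [] pᶜ⁺¹∣1 =
      contradiction (∣1⇒≡1 pᶜ⁺¹∣1) (>⇒≢ (^-monoʳ-< p (prime⇒1<p p-prime) (z<s {n = c})))
    ^∣lcmList⇒∈ {c} (x ∷ xs) pᶜ⁺¹∣lcm with ^∣lcm⇒⊎ {suc c} x (lcmList xs) pᶜ⁺¹∣lcm
    ... | inj₁ pᶜ⁺¹∣x  = x , here refl , pᶜ⁺¹∣x
    ... | inj₂ pᶜ⁺¹∣lcm′ with y , y∈xs , pᶜ⁺¹∣y ← ^∣lcmList⇒∈ {c} xs pᶜ⁺¹∣lcm′ =
      y , there y∈xs , pᶜ⁺¹∣y

-- lam a i unfolds definitionally to lcmList (gcds a i)
gcds : ∀ {s} → Tuple s → Fin s → List ℕ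
gcds {s} a i = map (λ j → gcd (a j) (a i)) (filter (λ j → ¬? (j ≟ i)) (allFin s))

module _ {s} (a : Tuple s) where

  gcd∈gcds : ∀ {i j} → j ≢ i → gcd (a j) (a i) ∈ gcds a i
  gcd∈gcds {i} {j} j≢i =
    ∈-map∘filter⁺ (λ j → gcd (a j) (a i)) (λ j → ¬? (j ≟ i)) (j , ∈-allFin j , refl , j≢i)

  ∈gcds⇒ : ∀ {i d} → d ∈ gcds a i → ∃[ j ] (j ≢ i × d ≡ gcd (a j) (a i))
  ∈gcds⇒ {i} d∈gcds
    with j , _ , d≡gcd , j≢i ←
           ∈-map∘filter⁻ (λ j → gcd (a j) (a i)) (λ j → ¬? (j ≟ i)) {xs = allFin s} d∈gcds =
    j , j≢i , d≡gcd

  common-divisor∣lam : ∀ {i j d} → j ≢ i → d ∣ a j → d ∣ a i → d ∣ lam a i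
  common-divisor∣lam j≢i d∣aⱼ d∣aᵢ = ∣-trans (gcd-greatest d∣aⱼ d∣aᵢ) (∈⇒∣lcmList (gcd∈gcds j≢i))

  lam∣ : ∀ i → lam a i ∣ a i
  lam∣ i = lcmList-least (gcds a i) λ d∈gcds → case ∈gcds⇒ d∈gcds of λ where
    (j , _ , refl) → gcd[m,n]∣n (a j) (a i)

  ^∣lam⇒ : ∀ {p c i} → Prime p → p ^ suc c ∣ lam a i → ∃[ j ] (j ≢ i × p ^ suc c ∣ a j × p ^ suc c ∣ a i)
  ^∣lam⇒ {c = c} {i} p-prime pᶜ⁺¹∣lam
    with d , d∈gcds , pᶜ⁺¹∣d ← ^∣lcmList⇒∈ p-prime {c} (gcds a i) pᶜ⁺¹∣lam
    with j , j≢i , refl ← ∈gcds⇒ d∈gcds =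
    j , j≢i , ∣-trans pᶜ⁺¹∣d (gcd[m,n]∣m (a j) (a i)) , ∣-trans pᶜ⁺¹∣d (gcd[m,n]∣n (a j) (a i))

  ^∤lam : ∀ {p K i} → Prime p → (∀ l → p ^ suc K ∣ a l → l ≡ i) → ∀ l → ¬ p ^ suc K ∣ lam a l
  ^∤lam {K = K} p-prime only-i l pᴷ⁺¹∣lam
    with j , j≢l , pᴷ⁺¹∣aⱼ , pᴷ⁺¹∣aₗ ← ^∣lam⇒ {c = K} p-prime pᴷ⁺¹∣lam =
    j≢l (trans (only-i j pᴷ⁺¹∣aⱼ) (sym (only-i l pᴷ⁺¹∣aₗ)))

max-attained : ∀ {n} (f : Fin (suc n) → ℕ) → ∃[ i ] (∀ j → f j ≤ f i)
max-attained f =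
  argmax f zero (allFin _) , λ j → All.lookup (f[xs]≤f[argmax] {f = f} zero (allFin _)) (∈-allFin j)

max-and-runnerUp : ∀ {s} → s ≥ 2 → (f : Fin s → ℕ) →
                   ∃[ i ] ∃[ j ] (i ≢ j × f j ≤ f i × (∀ l → l ≢ i → f l ≤ f j))
max-and-runnerUp (s≤s (s≤s _)) f = i , punchIn i j , punchInᵢ≢i i j ∘ sym , f≤fᵢ (punchIn i j) , fₗ≤fⱼ
  where
  i : Fin _
  i = proj₁ (max-attained f)
  f≤fᵢ : ∀ l → f l ≤ f i
  f≤fᵢ = proj₂ (max-attained f)
  j : Fin _
  j = proj₁ (max-attained (f ∘ punchIn i))
  fₗ≤fⱼ : ∀ l → l ≢ i → f l ≤ f (punchIn i j)
  fₗ≤fⱼ l l≢i = subst (λ l → f l ≤ f (punchIn i j)) (punchIn-punchOut (l≢i ∘ sym))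
                      (proj₂ (max-attained (f ∘ punchIn i)) (punchOut (l≢i ∘ sym)))

one-of-two-≢ : ∀ {n} {P : Fin n → Set} {i₁ i₂} → i₁ ≢ i₂ → P i₁ → P i₂ → ∀ i → ∃[ j ] (j ≢ i × P j)
one-of-two-≢ {i₁ = i₁} i₁≢i₂ P₁ P₂ i with i₁ ≟ i
... | yes refl = _ , i₁≢i₂ ∘ sym , P₂
... | no  i₁≢i = _ , i₁≢i , P₁

Realizable-resp-≗ : ∀ {s} {a b : Tuple s} → a ≗ b → Realizable a → Realizable b
Realizable-resp-≗ a≗b realizable p p-prime
  with i , j , i≢j , k , valᵢ , valⱼ , top ← realizable p p-prime =
  i , j , i≢j , k ,
  subst (λ n → IsVal p n k) (a≗b i) valᵢ ,
  subst (λ n → IsVal p n k) (a≗b j) valⱼ ,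
  λ l → subst (λ n → ¬ p ^ suc k ∣ n) (a≗b l) (top l)

lam-realizable : ∀ {s} → s ≥ 2 → (a : Tuple s) → Positive a → Realizable (lam a)
lam-realizable s≥2 a a⁺ p p-prime
  with e , val ← valuations (prime⇒1<p p-prime) a a⁺
  with i , j , i≢j , eⱼ≤eᵢ , eₗ≤eⱼ ← max-and-runnerUp s≥2 e =
  i , j , i≢j , e j ,
  (common-divisor∣lam a (i≢j ∘ sym) (pᵉ∣a j ≤-refl) (pᵉ∣a i eⱼ≤eᵢ) , top i) ,
  (common-divisor∣lam a i≢j (pᵉ∣a i eⱼ≤eᵢ) (pᵉ∣a j ≤-refl) , top j) ,
  top
  where
  pᵉ∣a : ∀ l → e j ≤ e l → p ^ e j ∣ a l
  pᵉ∣a l = IsVal⇒^∣ p (val l)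
  only-i : ∀ l → p ^ suc (e j) ∣ a l → l ≡ i
  only-i l pᵉ⁺¹∣aₗ with l ≟ i
  ... | yes l≡i = l≡i
  ... | no  l≢i = contradiction (eₗ≤eⱼ l l≢i) (<⇒≱ (^∤⇒≤ p (proj₂ (val l)) pᵉ⁺¹∣aₗ))
  top : ∀ l → ¬ p ^ suc (e j) ∣ lam a l
  top = ^∤lam a {K = e j} p-prime only-i

realizable⇒lam-fixes : ∀ {s} {m : Tuple s} → Positive m → Realizable m → lam m ≗ m
realizable⇒lam-fixes {m = m} m⁺ realizable i = prime-powers-∣⇒≡ (m⁺ i) (lam∣ m i) pᵏ∣mᵢ⇒pᵏ∣lam
  where
  pᵏ∣mᵢ⇒pᵏ∣lam : ∀ p k → Prime p → p ^ k ∣ m i → p ^ k ∣ lam m i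
  pᵏ∣mᵢ⇒pᵏ∣lam p k p-prime pᵏ∣mᵢ
    with i₁ , i₂ , i₁≢i₂ , K , val₁ , val₂ , top ← realizable p p-prime
    with j , j≢i , valⱼ ← one-of-two-≢ {P = λ j → IsVal p (m j) K} i₁≢i₂ val₁ val₂ i =
    common-divisor∣lam m j≢i (IsVal⇒^∣ p valⱼ (^∤⇒≤ p {K} {k} (top i) pᵏ∣mᵢ)) pᵏ∣mᵢ

proposition7 : (s : ℕ) → s ≥ 2 → (m : Tuple s) → Positive m →
    (InImage m ⇔ Realizable m)
proposition7 s s≥2 m m⁺ = mk⇔
  (λ (a , a⁺ , lam-a≗m) → Realizable-resp-≗ lam-a≗m (lam-realizable s≥2 a a⁺))
  (λ realizable → m , m⁺ , realizable⇒lam-fixes m⁺ realizable)
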